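{- Let $t\ge 1$ and $n\ge 1$ be integers. If $D\subseteq S_n$ is a $t$-transitive permutation group, then $D$ is a $t$-design in $(S_n,d_S)$. If $D\subseteq S_n$ is a $t$-design in $(S_n,d_S)$ that is a subgroup of $S_n$, then $D$ is a $t$-transitive permutation group.
   Context: $S_n$ is the symmetric group on $n$ letters, acting on $X=\{1,\dots,n\}$. A permutation group on $X$ is $t$-transitive if it acts transitively on the set of $t$-tuples of pairwise distinct elements of $X$. For $\nu\in S_n$ let $F(\nu)$ be its number of fixed points; the metric is $d_S(\sigma,\theta)=n-F(\sigma\theta^{ -1})$. For $j\in\{0,\dots,n\}$ let $v_j$ be the number of permutations with exactly $n-j$ fixed points. For nonempty $D\subseteq S_n$, its frequencies are $f_i=|\{(x,y)\in D^2: d_S(x,y)=i\}|/|D|^2$, $i=0,\dots,n$. $D$ is a $t$-design if $\sum_{j=0}^n f_j j^i=\sum_{j=0}^n \frac{v_j}{n!} j^i$ for every $i=1,\dots,t$. -}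

module Defs where

open import Data.Nat using (ℕ; zero; suc; _+_; _*_; _∸_; _^_; _≤_; _!)
open import Data.Nat.Properties using (_!≢0)
open import Data.Fin using (Fin; zero; suc)
open import Data.Fin.Properties using (any?) renaming (_≟_ to _≟ᶠ_)
open import Data.Vec using (Vec; []; _∷_; lookup; tabulate; toList)
open import Data.Vec.Properties using (≡-dec)
open import Data.List using (List; []; _∷_; length; filter; map; concatMap; allFin; cartesianProduct; upTo; foldr)
open import Data.List.Membership.Propositional using (_∈_)
open import Data.List.Relation.Unary.Unique.Propositional using (Unique)
import Data.List.Relation.Unary.Unique.DecPropositional as UDec
open import Data.Integer using (+_)
open import Data.Rational using (ℚ; _/_) renaming (_+_ to _+ℚ_; _*_ to _*ℚ_; 0ℚ to 0q)
open import Data.Product using (_×_; _,_; proj₁; proj₂; ∃; Σ)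
open import Relation.Binary.PropositionalEquality using (_≡_; _≢_)
open import Relation.Nullary using (yes; no)
import Data.Nat as ℕ

-- A permutation of X = Fin n is represented by its table of values:
-- σ(i) = lookup σ i.
Perm : ℕ → Set
Perm n = Vec (Fin n) n

allVecs : (n k : ℕ) → List (Vec (Fin n) k)
allVecs n zero    = [] ∷ []
allVecs n (suc k) = concatMap (λ x → map (x ∷_) (allVecs n k)) (allFin n)

Sym : (n : ℕ) → List (Perm n)
Sym n = filter (λ σ → UDec.unique? (_≟ᶠ_ {n}) (toList σ)) (allVecs n n)

idP : (n : ℕ) → Perm n
idP n = tabulate (λ i → i)

_∘P_ : {n : ℕ} → Perm n → Perm n → Perm n
σ ∘P θ = tabulate (λ i → lookup σ (lookup θ i))

invP : {n : ℕ} → Perm n → Perm n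
invP θ = tabulate (λ y → pick y (any? (λ x → lookup θ x ≟ᶠ y)))
  where
  pick : ∀ {n} {P : Fin n → Set} → Fin n → Relation.Nullary.Dec (∃ P) → Fin n
  pick y (yes (x , _)) = x
  pick y (no _)        = y

F : {n : ℕ} → Perm n → ℕ
F {n} ν = length (filter (λ i → lookup ν i ≟ᶠ i) (allFin n))

dS : {n : ℕ} → Perm n → Perm n → ℕ
dS {n} σ θ = n ∸ F (σ ∘P invP θ)

v : (n j : ℕ) → ℕ
v n j = length (filter (λ σ → F σ ℕ.≟ (n ∸ j)) (Sym n))

-- frequencies f_i of a (nonempty) list D; value 0 for the empty list (never used)
freq : {n : ℕ} → List (Perm n) → ℕ → ℚ
freq [] i = 0q
freq D@(x ∷ xs) i =
  (+ length (filter (λ p → dS (proj₁ p) (proj₂ p) ℕ.≟ i) (cartesianProduct D D)))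
    / (suc (length xs) * suc (length xs))

sumTo : ℕ → (ℕ → ℚ) → ℚ
sumTo n g = foldr (λ j acc → g j +ℚ acc) 0q (upTo (suc n))

ℕtoℚ : ℕ → ℚ
ℕtoℚ m = (+ m) / 1

IsDesign : (n t : ℕ) → List (Perm n) → Set
IsDesign n t D =
  (i : ℕ) → 1 ≤ i → i ≤ t →
  sumTo n (λ j → freq D j *ℚ ℕtoℚ (j ^ i))
    ≡ sumTo n (λ j → (_/_ (+ v n j) (n !) {{n !≢0}}) *ℚ ℕtoℚ (j ^ i))

IsSubsetSym : (n : ℕ) → List (Perm n) → Set
IsSubsetSym n D = Unique D × (∀ σ → σ ∈ D → σ ∈ Sym n)

IsSubgroup : (n : ℕ) → List (Perm n) → Set
IsSubgroup n D =
  IsSubsetSym n D ×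
  (idP n ∈ D) ×
  (∀ σ θ → σ ∈ D → θ ∈ D → (σ ∘P θ) ∈ D) ×
  (∀ σ → σ ∈ D → invP σ ∈ D)

Distinct : {n t : ℕ} → Vec (Fin n) t → Set
Distinct {t = t} a = ∀ (k l : Fin t) → lookup a k ≡ lookup a l → k ≡ l

IsTransitiveOn : (n t : ℕ) → List (Perm n) → Set
IsTransitiveOn n t D =
  (a b : Vec (Fin n) t) → Distinct a → Distinct b →
  Σ (Perm n) (λ σ → σ ∈ D × (∀ k → lookup σ (lookup a k) ≡ lookup b k))

IsTTransitiveGroup : (n t : ℕ) → List (Perm n) → Set
IsTTransitiveGroup n t D = IsSubgroup n D × IsTransitiveOn n t D

{-# OPTIONS --safe #-}

-- For a subgroup D of S_n the distance distribution of D is that of σ ↦ n − F(σ) on D, so the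
-- i-th design equation says that (n − F)^i has the same average over D as over S_n; by the
-- binomial theorem, having this for all i ≤ t is the same as having it for F^k, k ≤ t.
-- Burnside's lemma gives Σ_{σ∈G} F(σ)^k = Σ_x |Stab_G x| over all k-tuples x, and the
-- orbit–stabilizer theorem gives |Stab_D x|·|S_n| ≥ |Stab_{S_n} x|·|D|, with equality iff the
-- D-orbit of x is its whole S_n-orbit.  So F^k has the same average over D and S_n iff D has
-- the orbits of S_n on k-tuples; for k = t this is t-transitivity, and t-transitivity gives
-- these orbits for every k ≤ t ≤ n by extending the entries of a k-tuple to a distinct t-tuple.

module Submission where

open import Defs
open import Data.Bool using (if_then_else_)
open import Data.Bool.Properties using (T-≡)
open import Data.Empty using (⊥-elim)
open import Data.Fin using (Fin; zero; suc)
import Data.Fin.Permutation.Components as PC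
import Data.Fin.Properties as Fin
open import Data.Integer using () renaming (+_ to pos; _*_ to _*ℤ_; _+_ to _+ℤ_)
import Data.Integer.Properties as ℤ
import Data.Integer.Tactic.RingSolver as ℤ-Solver
open import Data.List using (List; []; _∷_; length; filter; map; foldr; _++_; concatMap; cartesianProduct; cartesianProductWith; allFin; upTo)
open import Data.List.Properties using (length-removeAt′; length-map; length-tabulate; length-filter; filter-≐; filter-none)
open import Data.List.Membership.Propositional using (_∈_; _∉_; _─_; find; lose)
open import Data.List.Membership.Propositional.Properties using (∈-map⁺; ∈-map⁻; ∈-filter⁺; ∈-filter⁻; ∈-concatMap⁺; ∈-allFin; ∈-length; ∈-upTo⁺; ∈-upTo⁻)
open import Data.List.Membership.Propositional.Properties.WithK using (unique∧set⇒bag)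
import Data.List.Membership.DecPropositional as DecMembership
open import Data.List.Relation.Binary.BagAndSetEquality using (∼bag⇒↭)
open import Data.List.Relation.Binary.Permutation.Propositional.Properties using (map⁺)
open import Data.List.Relation.Binary.Subset.Propositional using (_⊆_)
open import Data.List.Relation.Unary.All as All using ([]; _∷_)
open import Data.List.Relation.Unary.All.Properties using (¬Any⇒All¬; All¬⇒¬Any)
open import Data.List.Relation.Unary.AllPairs using ([]; _∷_)
open import Data.List.Relation.Unary.Any as Any using (Any; here; there; index)
open import Data.List.Relation.Unary.Unique.Propositional using (Unique)
import Data.List.Relation.Unary.Unique.Propositional.Properties as Unique
import Data.List.Relation.Unary.Unique.DecPropositional as UniqueDec
import Data.Nat as Nat
open import Data.Nat using (ℕ; zero; suc; pred; _+_; _*_; _∸_; _^_; _≤_; _<_; z≤n; s≤s; >-nonZero; _!; NonZero)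
open import Data.Nat.Combinatorics using (nPn≡n!)
open import Data.Nat.Combinatorics.Base using (_P′_)
open import Data.Nat.ListAction using (sum)
open import Data.Nat.ListAction.Properties using (sum-↭)
open import Data.Nat.Properties
open import Algebra.Properties.CommutativeSemigroup +-commutativeSemigroup using (interchange)
open import Data.Nat.Tactic.RingSolver using (solve-∀)
open import Data.Product using (Σ; _×_; _,_; proj₁; proj₂; ∃)
open import Data.Rational using (_/_; toℚᵘ; 0ℚ) renaming (_+_ to _+ℚ_; _*_ to _*ℚ_)
open import Data.Rational.Properties using (toℚᵘ-injective; toℚᵘ-fromℚᵘ; toℚᵘ-homo-+; toℚᵘ-homo-*; /-cong; normalize-injective-≃; 0/n≡0)
open import Data.Rational.Unnormalised using (mkℚᵘ; *≡*) renaming (_≃_ to _≃ᵘ_)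
import Data.Rational.Unnormalised.Properties as ℚᵘ
open import Data.Sum using (_⊎_; inj₁; inj₂)
open import Data.Vec as Vec using (Vec; []; _∷_; lookup; tabulate; toList)
open import Data.Vec.Properties using (length-toList; ≡-dec; lookup-map; lookup∘tabulate; tabulate∘lookup; tabulate-cong; ∷-injective)
open import Data.Vec.Membership.Propositional.Properties using (∈-toList⁺) renaming (∈-lookup to ∈ᵥ-lookup)
open import Function.Base using (_∘_)
open import Function.Bundles using (mk⇔; Equivalence; _⇔_)
open import Relation.Binary.Definitions using (DecidableEquality)
open import Relation.Binary.PropositionalEquality
open import Relation.Nullary using (Dec; yes; no; ¬?)
open import Relation.Nullary.Decidable using (dec-true; dec-false; decidable-stable)
open import Relation.Unary using (Pred; Decidable; _≐_)
open import Relation.Unary.Properties using (∁?)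

∑ : ∀ {a} {A : Set a} → (A → ℕ) → List A → ℕ
∑ f xs = sum (map f xs)

infix 5 ∑
syntax ∑ (λ x → e) xs = ∑[ x ∈ xs ] e

iverson : ∀ {p} {P : Set p} → Dec P → ℕ
iverson (yes _) = 1
iverson (no _)  = 0

∑-map : ∀ {a b} {A : Set a} {B : Set b} (f : B → ℕ) (g : A → B) (xs : List A) →
        ∑ f (map g xs) ≡ ∑[ x ∈ xs ] f (g x)
∑-map f g []       = refl
∑-map f g (x ∷ xs) = cong (f (g x) +_) (∑-map f g xs)

module _ {a} {A : Set a} where

  ∑-cong : ∀ {f g : A → ℕ} xs → (∀ {x} → x ∈ xs → f x ≡ g x) → ∑ f xs ≡ ∑ g xs
  ∑-cong []       f≡g = refl
  ∑-cong (x ∷ xs) f≡g = cong₂ _+_ (f≡g (here refl)) (∑-cong xs (λ y∈ → f≡g (there y∈)))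

  ∑-mono-≤ : ∀ {f g : A → ℕ} xs → (∀ {x} → x ∈ xs → f x ≤ g x) → ∑ f xs ≤ ∑ g xs
  ∑-mono-≤ []       f≤g = z≤n
  ∑-mono-≤ (x ∷ xs) f≤g = +-mono-≤ (f≤g (here refl)) (∑-mono-≤ xs (λ y∈ → f≤g (there y∈)))

  ∑-+ : (f g : A → ℕ) (xs : List A) → ∑[ x ∈ xs ] (f x + g x) ≡ ∑ f xs + ∑ g xs
  ∑-+ f g []       = refl
  ∑-+ f g (x ∷ xs) = trans (cong (f x + g x +_) (∑-+ f g xs)) (interchange (f x) (g x) _ _)

  ∑-*ˡ : (c : ℕ) (f : A → ℕ) (xs : List A) → ∑[ x ∈ xs ] (c * f x) ≡ c * ∑ f xs
  ∑-*ˡ c f []       = sym (*-zeroʳ c)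
  ∑-*ˡ c f (x ∷ xs) = trans (cong (c * f x +_) (∑-*ˡ c f xs)) (sym (*-distribˡ-+ c (f x) _))

  ∑-*ʳ : (c : ℕ) (f : A → ℕ) (xs : List A) → ∑[ x ∈ xs ] (f x * c) ≡ ∑ f xs * c
  ∑-*ʳ c f xs = trans (∑-cong xs (λ {x} _ → *-comm (f x) c)) (trans (∑-*ˡ c f xs) (*-comm c _))

  ∑-const : (c : ℕ) (xs : List A) → ∑[ x ∈ xs ] c ≡ length xs * c
  ∑-const c []       = refl
  ∑-const c (x ∷ xs) = cong (c +_) (∑-const c xs)

  ∑-1 : (xs : List A) → ∑[ x ∈ xs ] 1 ≡ length xs
  ∑-1 xs = trans (∑-const 1 xs) (*-identityʳ (length xs))

  ∑-zero : ∀ {f : A → ℕ} (xs : List A) → (∀ {x} → x ∈ xs → f x ≡ 0) → ∑ f xs ≡ 0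
  ∑-zero xs f≡0 = trans (∑-cong xs f≡0) (trans (∑-const 0 xs) (*-zeroʳ (length xs)))

  ∑-++ : (f : A → ℕ) (xs ys : List A) → ∑ f (xs ++ ys) ≡ ∑ f xs + ∑ f ys
  ∑-++ f []       ys = refl
  ∑-++ f (x ∷ xs) ys = trans (cong (f x +_) (∑-++ f xs ys)) (sym (+-assoc (f x) _ _))

  length-filter≡∑-iverson : ∀ {p} {P : Pred A p} (P? : Decidable P) (xs : List A) →
                            length (filter P? xs) ≡ ∑[ x ∈ xs ] iverson (P? x)
  length-filter≡∑-iverson P? []       = refl
  length-filter≡∑-iverson P? (x ∷ xs) with P? x
  ... | yes _ = cong suc (length-filter≡∑-iverson P? xs)
  ... | no _  = length-filter≡∑-iverson P? xs

  ∑-≤-≡⇒≡ : ∀ {f g : A → ℕ} xs → (∀ {x} → x ∈ xs → f x ≤ g x) → ∑ f xs ≡ ∑ g xs →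
            ∀ {x} → x ∈ xs → f x ≡ g x
  ∑-≤-≡⇒≡ {f} {g} (y ∷ xs) f≤g sum≡ = go
    where
    rest≤ : ∑ f xs ≤ ∑ g xs
    rest≤ = ∑-mono-≤ xs (λ x∈ → f≤g (there x∈))
    head≡ : f y ≡ g y
    head≡ = ≤-antisym (f≤g (here refl)) (+-cancelʳ-≤ (∑ f xs) (g y) (f y)
              (≤-trans (+-monoʳ-≤ (g y) rest≤) (≤-reflexive (sym sum≡))))
    rest≡ : ∑ f xs ≡ ∑ g xs
    rest≡ = +-cancelˡ-≡ (f y) _ _ (trans sum≡ (cong (_+ ∑ g xs) (sym head≡)))
    go : ∀ {x} → x ∈ y ∷ xs → f x ≡ g x
    go (here refl) = head≡
    go (there x∈)  = ∑-≤-≡⇒≡ xs (λ z∈ → f≤g (there z∈)) rest≡ x∈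

  ∑-iverson-≟ : (_≟_ : DecidableEquality A) (g : A → ℕ) {c : A} {ys : List A} → Unique ys → c ∈ ys →
                ∑[ y ∈ ys ] (iverson (c ≟ y) * g y) ≡ g c
  ∑-iverson-≟ _≟_ g {c} {y ∷ ys} (c∉ys ∷ u) c∈ with c ≟ y
  ... | yes refl = trans (cong (1 * g c +_) (∑-zero ys off)) (trans (+-identityʳ _) (*-identityˡ (g c)))
    where
    off : ∀ {z} → z ∈ ys → iverson (c ≟ z) * g z ≡ 0
    off {z} z∈ with c ≟ z
    ... | yes c≡z = ⊥-elim (All.lookup c∉ys z∈ c≡z)
    ... | no _    = refl
  ... | no c≢y = ∑-iverson-≟ _≟_ g u (tail c∈)
    where
    tail : c ∈ y ∷ ys → c ∈ ys
    tail (here c≡y) = ⊥-elim (c≢y c≡y)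
    tail (there c∈) = c∈

  unique∧set⇒∑≡ : (f : A → ℕ) {xs ys : List A} → Unique xs → Unique ys → xs ⊆ ys → ys ⊆ xs →
                  ∑ f xs ≡ ∑ f ys
  unique∧set⇒∑≡ f uxs uys xs⊆ys ys⊆xs =
    sum-↭ (map⁺ f (∼bag⇒↭ (unique∧set⇒bag uxs uys (mk⇔ xs⊆ys ys⊆xs))))

module _ {a b} {A : Set a} {B : Set b} where

  ∑-swap : (f : A → B → ℕ) (xs : List A) (ys : List B) →
           ∑[ x ∈ xs ] ∑[ y ∈ ys ] f x y ≡ ∑[ y ∈ ys ] ∑[ x ∈ xs ] f x y
  ∑-swap f []       ys = sym (∑-zero ys (λ _ → refl))
  ∑-swap f (x ∷ xs) ys = trans (cong (∑ (f x) ys +_) (∑-swap f xs ys))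
                               (sym (∑-+ (f x) (λ y → ∑[ x′ ∈ xs ] f x′ y) ys))

  ∑-concatMap : (f : B → ℕ) (g : A → List B) (xs : List A) → ∑ f (concatMap g xs) ≡ ∑[ x ∈ xs ] ∑ f (g x)
  ∑-concatMap f g []       = refl
  ∑-concatMap f g (x ∷ xs) = trans (∑-++ f (g x) (concatMap g xs)) (cong (∑ f (g x) +_) (∑-concatMap f g xs))

  ∑-cartesianProduct : (f : A × B → ℕ) (xs : List A) (ys : List B) →
                       ∑ f (cartesianProduct xs ys) ≡ ∑[ x ∈ xs ] ∑[ y ∈ ys ] f (x , y)
  ∑-cartesianProduct f []       ys = refl
  ∑-cartesianProduct f (x ∷ xs) ys =
    trans (∑-++ f (map (x ,_) ys) _) (cong₂ _+_ (∑-map f (x ,_) ys) (∑-cartesianProduct f xs ys))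

  ∑-fibres : (_≟_ : DecidableEquality B) (f : A → B) (g : B → ℕ) (xs : List A) {ys : List B} →
             Unique ys → (∀ {x} → x ∈ xs → f x ∈ ys) →
             ∑[ y ∈ ys ] (length (filter (λ x → f x ≟ y) xs) * g y) ≡ ∑[ x ∈ xs ] g (f x)
  ∑-fibres _≟_ f g xs {ys} uys f∈ = begin
      ∑[ y ∈ ys ] (length (filter (λ x → f x ≟ y) xs) * g y)
    ≡⟨ ∑-cong ys (λ {y} _ → trans (cong (_* g y) (length-filter≡∑-iverson (λ x → f x ≟ y) xs))
                                  (sym (∑-*ʳ (g y) (λ x → iverson (f x ≟ y)) xs))) ⟩
      ∑[ y ∈ ys ] ∑[ x ∈ xs ] (iverson (f x ≟ y) * g y)
    ≡⟨ sym (∑-swap (λ x y → iverson (f x ≟ y) * g y) xs ys) ⟩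
      ∑[ x ∈ xs ] ∑[ y ∈ ys ] (iverson (f x ≟ y) * g y)
    ≡⟨ ∑-cong xs (λ x∈ → ∑-iverson-≟ _≟_ g uys (f∈ x∈)) ⟩
      ∑[ x ∈ xs ] g (f x) ∎
    where open ≡-Reasoning

module _ {a} {A : Set a} where

  ∈-─⁺ : ∀ {x y : A} {xs} (x∈ : x ∈ xs) → y ∈ xs → y ≢ x → y ∈ xs ─ x∈
  ∈-─⁺ (here refl) (here refl) y≢x = ⊥-elim (y≢x refl)
  ∈-─⁺ (here _)    (there y∈)  _   = y∈
  ∈-─⁺ (there _)   (here refl) _   = here refl
  ∈-─⁺ (there x∈)  (there y∈)  y≢x = there (∈-─⁺ x∈ y∈ y≢x)

  Unique∧⊆⇒length≤ : ∀ {xs ys : List A} → Unique xs → xs ⊆ ys → length xs ≤ length ys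
  Unique∧⊆⇒length≤ {[]}     _          _  = z≤n
  Unique∧⊆⇒length≤ {x ∷ xs} {ys} (x∉xs ∷ u) x∷xs⊆ys =
    subst (suc (length xs) ≤_) (sym (length-removeAt′ ys (index x∈ys)))
      (s≤s (Unique∧⊆⇒length≤ u (λ y∈ → ∈-─⁺ x∈ys (x∷xs⊆ys (there y∈)) (y≢x y∈))))
    where
    x∈ys = x∷xs⊆ys (here refl)
    y≢x : ∀ {y} → y ∈ xs → y ≢ x
    y≢x y∈ y≡x = All.lookup x∉xs y∈ (sym y≡x)

  Unique∧⊆∧length≥⇒⊇ : DecidableEquality A → ∀ {xs ys : List A} → Unique xs → xs ⊆ ys →
                       length ys ≤ length xs → ys ⊆ xs
  Unique∧⊆∧length≥⇒⊇ _≟_ {xs} {ys} uxs xs⊆ys ys≤xs {y} y∈ys with DecMembership._∈?_ _≟_ y xs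
  ... | yes y∈xs = y∈xs
  ... | no  y∉xs =
    ⊥-elim (<-irrefl refl (≤-trans (Unique∧⊆⇒length≤ (¬Any⇒All¬ xs y∉xs ∷ uxs) y∷xs⊆ys) ys≤xs))
    where
    y∷xs⊆ys : y ∷ xs ⊆ ys
    y∷xs⊆ys (here refl) = y∈ys
    y∷xs⊆ys (there x∈)  = xs⊆ys x∈

module _ {a b} {A : Set a} {B : Set b} where

  Injective∧maps⇒length≤ : ∀ {f : A → B} {xs ys} → (∀ {x y} → f x ≡ f y → x ≡ y) → Unique xs →
                           (∀ {x} → x ∈ xs → f x ∈ ys) → length xs ≤ length ys
  Injective∧maps⇒length≤ {f} {xs} f-inj uxs f∈ =
    subst (_≤ _) (length-map f xs) (Unique∧⊆⇒length≤ (Unique.map⁺ f-inj uxs) image⊆)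
    where
    image⊆ : map f xs ⊆ _
    image⊆ y∈ with ∈-map⁻ f y∈
    ... | x , x∈ , refl = f∈ x∈

lookup⇒≡ : ∀ {a} {A : Set a} {k} {u w : Vec A k} → (∀ i → lookup u i ≡ lookup w i) → u ≡ w
lookup⇒≡ {u = u} {w} u≗w = trans (sym (tabulate∘lookup u)) (trans (tabulate-cong u≗w) (tabulate∘lookup w))

∈-toList⇒lookup : ∀ {a} {A : Set a} {k} {y : A} (w : Vec A k) → y ∈ toList w → ∃ λ l → lookup w l ≡ y
∈-toList⇒lookup (x ∷ w) (here refl) = zero , refl
∈-toList⇒lookup (x ∷ w) (there y∈) with ∈-toList⇒lookup w y∈
... | l , wₗ≡y = suc l , wₗ≡y

module _ {n : ℕ} where

  Unique⇒Distinct : ∀ {k} (w : Vec (Fin n) k) → Unique (toList w) → Distinct w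
  Unique⇒Distinct (x ∷ w) (x∉w ∷ u) zero    zero    _   = refl
  Unique⇒Distinct (x ∷ w) (x∉w ∷ u) zero    (suc j) x≡wⱼ =
    ⊥-elim (All.lookup x∉w (∈-toList⁺ (∈ᵥ-lookup j w)) x≡wⱼ)
  Unique⇒Distinct (x ∷ w) (x∉w ∷ u) (suc i) zero    wᵢ≡x =
    ⊥-elim (All.lookup x∉w (∈-toList⁺ (∈ᵥ-lookup i w)) (sym wᵢ≡x))
  Unique⇒Distinct (x ∷ w) (x∉w ∷ u) (suc i) (suc j) wᵢ≡wⱼ = cong suc (Unique⇒Distinct w u i j wᵢ≡wⱼ)

  Distinct⇒Unique : ∀ {k} (w : Vec (Fin n) k) → Distinct w → Unique (toList w)
  Distinct⇒Unique []      _ = []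
  Distinct⇒Unique (x ∷ w) d = All.tabulate x∉w ∷ Distinct⇒Unique w (λ i j e → Fin.suc-injective (d (suc i) (suc j) e))
    where
    x∉w : ∀ {y} → y ∈ toList w → x ≢ y
    x∉w y∈ refl with ∈-toList⇒lookup w y∈
    ... | l , wₗ≡x with () ← d zero (suc l) (sym wₗ≡x)

  allVecs-Unique : ∀ k → Unique (allVecs n k)
  allVecs-Unique zero    = [] ∷ []
  allVecs-Unique (suc k) = subst Unique (sym (concatMap-map≡cartesianProductWith _∷_ (allFin n) (allVecs n k)))
    (Unique.cartesianProductWith⁺ _∷_ ∷-injective (Unique.allFin⁺ n) (allVecs-Unique k))
    where
    concatMap-map≡cartesianProductWith : ∀ {A B C : Set} (g : A → B → C) xs ys →
      concatMap (λ x → map (g x) ys) xs ≡ cartesianProductWith g xs ys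
    concatMap-map≡cartesianProductWith g []       ys = refl
    concatMap-map≡cartesianProductWith g (x ∷ xs) ys =
      cong (map (g x) ys ++_) (concatMap-map≡cartesianProductWith g xs ys)

  ∈-allVecs : ∀ {k} (w : Vec (Fin n) k) → w ∈ allVecs n k
  ∈-allVecs []      = here refl
  ∈-allVecs (x ∷ w) = ∈-concatMap⁺ (λ z → map (z ∷_) (allVecs n _))
    (Any.map (λ { refl → ∈-map⁺ (x ∷_) (∈-allVecs w) }) (∈-allFin x))

  ∈-Sym⁺ : ∀ (σ : Perm n) → Distinct σ → σ ∈ Sym n
  ∈-Sym⁺ σ d = ∈-filter⁺ (λ σ → UniqueDec.unique? Fin._≟_ (toList σ)) (∈-allVecs σ) (Distinct⇒Unique σ d)

  ∈-Sym⁻ : ∀ {σ : Perm n} → σ ∈ Sym n → Distinct σ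
  ∈-Sym⁻ {σ} σ∈ =
    Unique⇒Distinct σ (proj₂ (∈-filter⁻ (λ σ → UniqueDec.unique? Fin._≟_ (toList σ)) {xs = allVecs n n} σ∈))

  Sym-Unique : Unique (Sym n)
  Sym-Unique = Unique.filter⁺ _ (allVecs-Unique n)

  lookup-∘P : ∀ (σ θ : Perm n) i → lookup (σ ∘P θ) i ≡ lookup σ (lookup θ i)
  lookup-∘P σ θ i = lookup∘tabulate _ i

  lookup-idP : ∀ i → lookup (idP n) i ≡ i
  lookup-idP i = lookup∘tabulate _ i

  Distinct-idP : Distinct (idP n)
  Distinct-idP i j e = trans (sym (lookup-idP i)) (trans e (lookup-idP j))

  Distinct-∘P : ∀ (σ θ : Perm n) → Distinct σ → Distinct θ → Distinct (σ ∘P θ)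
  Distinct-∘P σ θ dσ dθ i j e = dθ i j (dσ _ _ (trans (sym (lookup-∘P σ θ i)) (trans e (lookup-∘P σ θ j))))

  Distinct⇒surjective : ∀ (σ : Perm n) → Distinct σ → ∀ y → ∃ λ x → lookup σ x ≡ y
  Distinct⇒surjective σ d y with ∈-map⁻ (lookup σ) (allFin⊆image (∈-allFin y))
    where
    image-Unique : Unique (map (lookup σ) (allFin n))
    image-Unique = Unique.map⁺ (d _ _) (Unique.allFin⁺ n)
    allFin⊆image : allFin n ⊆ map (lookup σ) (allFin n)
    allFin⊆image = Unique∧⊆∧length≥⇒⊇ Fin._≟_ image-Unique (λ {z} _ → ∈-allFin z)
                     (≤-reflexive (sym (length-map (lookup σ) (allFin n))))
  ... | x , _ , y≡σx = x , sym y≡σx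

  -- The right-hand side is the choice function local to invP, which cannot be named here.
  lookup-invP : ∀ (σ : Perm n) y → lookup (invP σ) y ≡ _
  lookup-invP σ y = lookup∘tabulate _ y

  invP-inverseʳ : ∀ (σ : Perm n) → Distinct σ → ∀ y → lookup σ (lookup (invP σ) y) ≡ y
  invP-inverseʳ σ d y rewrite lookup-invP σ y with Fin.any? (λ x → lookup σ x Fin.≟ y)
  ... | yes (x , σx≡y) = σx≡y
  ... | no  ∄x        = ⊥-elim (∄x (Distinct⇒surjective σ d y))

  invP-inverseˡ : ∀ (σ : Perm n) → Distinct σ → ∀ x → lookup (invP σ) (lookup σ x) ≡ x
  invP-inverseˡ σ d x = d _ _ (invP-inverseʳ σ d (lookup σ x))

  Distinct-invP : ∀ (σ : Perm n) → Distinct σ → Distinct (invP σ)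
  Distinct-invP σ d i j e = trans (sym (invP-inverseʳ σ d i)) (trans (cong (lookup σ) e) (invP-inverseʳ σ d j))

  ∘P-cancelˡ : ∀ (α : Perm n) → Distinct α → ∀ {ρ ρ′} → α ∘P ρ ≡ α ∘P ρ′ → ρ ≡ ρ′
  ∘P-cancelˡ α d {ρ} {ρ′} e = lookup⇒≡ λ i →
    d _ _ (trans (sym (lookup-∘P α ρ i)) (trans (cong (λ π → lookup π i) e) (lookup-∘P α ρ′ i)))

  ∘P-cancelʳ : ∀ (α : Perm n) → Distinct α → ∀ {ρ ρ′} → ρ ∘P α ≡ ρ′ ∘P α → ρ ≡ ρ′
  ∘P-cancelʳ α d {ρ} {ρ′} e = lookup⇒≡ λ i → begin
      lookup ρ i                           ≡⟨ cong (lookup ρ) (invP-inverseʳ α d i) ⟨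
      lookup ρ (lookup α (lookup (invP α) i))   ≡⟨ lookup-∘P ρ α _ ⟨
      lookup (ρ ∘P α) (lookup (invP α) i)  ≡⟨ cong (λ π → lookup π (lookup (invP α) i)) e ⟩
      lookup (ρ′ ∘P α) (lookup (invP α) i) ≡⟨ lookup-∘P ρ′ α _ ⟩
      lookup ρ′ (lookup α (lookup (invP α) i))  ≡⟨ cong (lookup ρ′) (invP-inverseʳ α d i) ⟩
      lookup ρ′ i ∎
    where open ≡-Reasoning

  Sym-isSubgroup : IsSubgroup n (Sym n)
  Sym-isSubgroup = (Sym-Unique , λ _ σ∈ → σ∈) , ∈-Sym⁺ (idP n) Distinct-idP
                 , (λ σ θ σ∈ θ∈ → ∈-Sym⁺ (σ ∘P θ) (Distinct-∘P σ θ (∈-Sym⁻ σ∈) (∈-Sym⁻ θ∈)))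
                 , (λ σ σ∈ → ∈-Sym⁺ (invP σ) (Distinct-invP σ (∈-Sym⁻ σ∈)))

module Subgroup {n : ℕ} {G : List (Perm n)} (sg : IsSubgroup n G) where

  unique : Unique G
  unique = proj₁ (proj₁ sg)

  idP∈ : idP n ∈ G
  idP∈ = proj₁ (proj₂ sg)

  ∘P-closed : ∀ {σ θ} → σ ∈ G → θ ∈ G → σ ∘P θ ∈ G
  ∘P-closed = proj₁ (proj₂ (proj₂ sg)) _ _

  invP-closed : ∀ {σ} → σ ∈ G → invP σ ∈ G
  invP-closed = proj₂ (proj₂ (proj₂ sg)) _

  ⊆Sym : G ⊆ Sym n
  ⊆Sym = proj₂ (proj₁ sg) _

  distinct : ∀ {σ} → σ ∈ G → Distinct σ
  distinct σ∈ = ∈-Sym⁻ (⊆Sym σ∈)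

-- Burnside's lemma and the orbit–stabilizer theorem for the action on k-tuples

module _ {n k : ℕ} where

  _≟ᵗ_ : DecidableEquality (Vec (Fin n) k)
  _≟ᵗ_ = ≡-dec Fin._≟_

  act : Perm n → Vec (Fin n) k → Vec (Fin n) k
  act σ x = Vec.map (lookup σ) x

  lookup-act : ∀ (σ : Perm n) x l → lookup (act σ x) l ≡ lookup σ (lookup x l)
  lookup-act σ x l = lookup-map l (lookup σ) x

  act-∘P : ∀ (σ θ : Perm n) x → act (σ ∘P θ) x ≡ act σ (act θ x)
  act-∘P σ θ x = lookup⇒≡ λ l → begin
    lookup (act (σ ∘P θ) x) l          ≡⟨ lookup-act (σ ∘P θ) x l ⟩
    lookup (σ ∘P θ) (lookup x l)      ≡⟨ lookup-∘P σ θ (lookup x l) ⟩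
    lookup σ (lookup θ (lookup x l))  ≡⟨ cong (lookup σ) (lookup-act θ x l) ⟨
    lookup σ (lookup (act θ x) l)     ≡⟨ lookup-act σ (act θ x) l ⟨
    lookup (act σ (act θ x)) l        ∎
    where open ≡-Reasoning

  act-idP : ∀ x → act (idP n) x ≡ x
  act-idP x = lookup⇒≡ λ l → trans (lookup-act (idP n) x l) (lookup-idP (lookup x l))

  transporters : List (Perm n) → Vec (Fin n) k → Vec (Fin n) k → List (Perm n)
  transporters G x y = filter (λ σ → act σ x ≟ᵗ y) G

  stabilizer : List (Perm n) → Vec (Fin n) k → List (Perm n)
  stabilizer G x = transporters G x x

  InOrbit? : (G : List (Perm n)) (x y : Vec (Fin n) k) → Dec (Any (λ σ → act σ x ≡ y) G)
  InOrbit? G x y = Any.any? (λ σ → act σ x ≟ᵗ y) G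

  orbit : List (Perm n) → Vec (Fin n) k → List (Vec (Fin n) k)
  orbit G x = filter (InOrbit? G x) (allVecs n k)

  orbit-Unique : ∀ G x → Unique (orbit G x)
  orbit-Unique G x = Unique.filter⁺ _ (allVecs-Unique k)

  ∈-orbit⁺ : ∀ {G x y σ} → σ ∈ G → act σ x ≡ y → y ∈ orbit G x
  ∈-orbit⁺ {G} {x} {y} σ∈ σx≡y = ∈-filter⁺ (InOrbit? G x) (∈-allVecs y) (lose σ∈ σx≡y)

  ∈-orbit⁻ : ∀ {G x y} → y ∈ orbit G x → ∃ λ σ → σ ∈ G × act σ x ≡ y
  ∈-orbit⁻ {G} {x} y∈ = find (proj₂ (∈-filter⁻ (InOrbit? G x) {xs = allVecs n k} y∈))

  module _ {G : List (Perm n)} (sg : IsSubgroup n G) (x : Vec (Fin n) k) where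
    open Subgroup sg

    transporters-length : ∀ {τ y} → τ ∈ G → act τ x ≡ y →
                          length (transporters G x y) ≡ length (stabilizer G x)
    transporters-length {τ} {y} τ∈ τx≡y = ≤-antisym
      (Injective∧maps⇒length≤ (∘P-cancelˡ (invP τ) (Distinct-invP τ dτ)) (Unique.filter⁺ _ unique) back)
      (Injective∧maps⇒length≤ (∘P-cancelˡ τ dτ) (Unique.filter⁺ _ unique) forth)
      where
      dτ = distinct τ∈
      forth : ∀ {ρ} → ρ ∈ stabilizer G x → τ ∘P ρ ∈ transporters G x y
      forth {ρ} ρ∈ with ∈-filter⁻ (λ σ → act σ x ≟ᵗ x) {xs = G} ρ∈
      ... | ρ∈G , ρx≡x = ∈-filter⁺ (λ σ → act σ x ≟ᵗ y) (∘P-closed τ∈ ρ∈G)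
                           (trans (act-∘P τ ρ x) (trans (cong (act τ) ρx≡x) τx≡y))
      invP-τy≡x : act (invP τ) y ≡ x
      invP-τy≡x = begin
        act (invP τ) y           ≡⟨ cong (act (invP τ)) τx≡y ⟨
        act (invP τ) (act τ x)   ≡⟨ act-∘P (invP τ) τ x ⟨
        act (invP τ ∘P τ) x      ≡⟨ lookup⇒≡ (λ l → trans (lookup-act (invP τ ∘P τ) x l)
                                      (trans (lookup-∘P (invP τ) τ _) (invP-inverseˡ τ dτ (lookup x l)))) ⟩
        x                        ∎
        where open ≡-Reasoning
      back : ∀ {ρ} → ρ ∈ transporters G x y → invP τ ∘P ρ ∈ stabilizer G x
      back {ρ} ρ∈ with ∈-filter⁻ (λ σ → act σ x ≟ᵗ y) {xs = G} ρ∈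
      ... | ρ∈G , ρx≡y = ∈-filter⁺ (λ σ → act σ x ≟ᵗ x) (∘P-closed (invP-closed τ∈) ρ∈G)
                           (trans (act-∘P (invP τ) ρ x) (trans (cong (act (invP τ)) ρx≡y) invP-τy≡x))

    transporters-length≡iverson : ∀ y →
      length (transporters G x y) ≡ iverson (InOrbit? G x y) * length (stabilizer G x)
    transporters-length≡iverson y with InOrbit? G x y
    ... | yes ∃τ = let τ , τ∈ , τx≡y = find ∃τ in
                   trans (transporters-length τ∈ τx≡y) (sym (+-identityʳ _))
    ... | no ∄τ  = cong length (filter-none (λ σ → act σ x ≟ᵗ y) (¬Any⇒All¬ G ∄τ))

    orbit-stabilizer : length G ≡ length (stabilizer G x) * length (orbit G x)
    orbit-stabilizer = begin
      length G
        ≡⟨ ∑-1 G ⟨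
      ∑[ σ ∈ G ] 1
        ≡⟨ ∑-fibres _≟ᵗ_ (λ σ → act σ x) (λ _ → 1) G (allVecs-Unique k) (λ {σ} _ → ∈-allVecs (act σ x)) ⟨
      ∑[ y ∈ allVecs n k ] (length (transporters G x y) * 1)
        ≡⟨ ∑-cong (allVecs n k) (λ {y} _ → trans (*-identityʳ _)
             (trans (transporters-length≡iverson y) (*-comm (iverson (InOrbit? G x y)) _))) ⟩
      ∑[ y ∈ allVecs n k ] (length (stabilizer G x) * iverson (InOrbit? G x y))
        ≡⟨ ∑-*ˡ (length (stabilizer G x)) (λ y → iverson (InOrbit? G x y)) (allVecs n k) ⟩
      length (stabilizer G x) * (∑[ y ∈ allVecs n k ] iverson (InOrbit? G x y))
        ≡⟨ cong (length (stabilizer G x) *_) (length-filter≡∑-iverson (InOrbit? G x) (allVecs n k)) ⟨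
      length (stabilizer G x) * length (orbit G x) ∎
      where open ≡-Reasoning

module _ {n : ℕ} where

  ∑-fixedTuples : ∀ (σ : Perm n) k → ∑[ x ∈ allVecs n k ] iverson (act σ x ≟ᵗ x) ≡ F σ ^ k
  ∑-fixedTuples σ zero    = refl
  ∑-fixedTuples σ (suc k) = begin
    ∑[ x ∈ allVecs n (suc k) ] iverson (act σ x ≟ᵗ x)
      ≡⟨ ∑-concatMap (λ x → iverson (act σ x ≟ᵗ x)) (λ a → map (a ∷_) (allVecs n k)) (allFin n) ⟩
    ∑[ a ∈ allFin n ] ∑[ x ∈ map (a ∷_) (allVecs n k) ] iverson (act σ x ≟ᵗ x)
      ≡⟨ ∑-cong (allFin n) (λ {a} _ → trans (∑-map (λ x → iverson (act σ x ≟ᵗ x)) (a ∷_) (allVecs n k))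
           (trans (∑-cong (allVecs n k) (λ {w} _ → iverson-∷ a w))
                  (∑-*ˡ (fixes a) (λ w → iverson (act σ w ≟ᵗ w)) (allVecs n k)))) ⟩
    ∑[ a ∈ allFin n ] (fixes a * (∑[ w ∈ allVecs n k ] iverson (act σ w ≟ᵗ w)))
      ≡⟨ ∑-*ʳ _ fixes (allFin n) ⟩
    ∑ fixes (allFin n) * (∑[ w ∈ allVecs n k ] iverson (act σ w ≟ᵗ w))
      ≡⟨ cong₂ _*_ (sym (length-filter≡∑-iverson (λ i → lookup σ i Fin.≟ i) (allFin n))) (∑-fixedTuples σ k) ⟩
    F σ * F σ ^ k ∎
    where
    open ≡-Reasoning
    fixes : Fin n → ℕ
    fixes a = iverson (lookup σ a Fin.≟ a)
    iverson-∷ : ∀ {k} a (w : Vec (Fin n) k) →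
                iverson (act σ (a ∷ w) ≟ᵗ (a ∷ w)) ≡ fixes a * iverson (act σ w ≟ᵗ w)
    iverson-∷ a w with lookup σ a Fin.≟ a | act σ w ≟ᵗ w
    ... | yes _ | yes _ = refl
    ... | yes _ | no _  = refl
    ... | no _  | _     = refl

  burnside : ∀ k (G : List (Perm n)) → ∑[ σ ∈ G ] F σ ^ k ≡ ∑[ x ∈ allVecs n k ] length (stabilizer G x)
  burnside k G = begin
    ∑[ σ ∈ G ] F σ ^ k
      ≡⟨ ∑-cong G (λ {σ} _ → ∑-fixedTuples σ k) ⟨
    ∑[ σ ∈ G ] ∑[ x ∈ allVecs n k ] iverson (act σ x ≟ᵗ x)
      ≡⟨ ∑-swap (λ σ x → iverson (act σ x ≟ᵗ x)) G (allVecs n k) ⟩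
    ∑[ x ∈ allVecs n k ] ∑[ σ ∈ G ] iverson (act σ x ≟ᵗ x)
      ≡⟨ ∑-cong (allVecs n k) (λ {x} _ → length-filter≡∑-iverson (λ σ → act σ x ≟ᵗ x) G) ⟨
    ∑[ x ∈ allVecs n k ] length (stabilizer G x) ∎
    where open ≡-Reasoning

SameAverage : ∀ {a} {A : Set a} → (A → ℕ) → List A → List A → Set
SameAverage f xs ys = ∑ f xs * length ys ≡ ∑ f ys * length xs

module _ {n k : ℕ} {G H : List (Perm n)} (sgG : IsSubgroup n G) (sgH : IsSubgroup n H) (G⊆H : G ⊆ H) where

  orbit-⊆ : ∀ (x : Vec (Fin n) k) → orbit G x ⊆ orbit H x
  orbit-⊆ x y∈ with ∈-orbit⁻ {G = G} {x} y∈
  ... | σ , σ∈ , σx≡y = ∈-orbit⁺ (G⊆H σ∈) σx≡y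

  private
    stabilizer-length>0 : ∀ {K} → IsSubgroup n K → (x : Vec (Fin n) k) → 0 < length (stabilizer K x)
    stabilizer-length>0 sgK x = ∈-length (∈-filter⁺ (λ σ → act σ x ≟ᵗ x) (Subgroup.idP∈ sgK) (act-idP x))

    module Counts (x : Vec (Fin n) k) where
      a = length (stabilizer G x)
      b = length (stabilizer H x)

      a*|H| : a * length H ≡ (a * b) * length (orbit H x)
      a*|H| = trans (cong (a *_) (orbit-stabilizer sgH x)) (sym (*-assoc a b _))

      b*|G| : b * length G ≡ (a * b) * length (orbit G x)
      b*|G| = trans (cong (b *_) (orbit-stabilizer sgG x))
                    (trans (sym (*-assoc b a _)) (cong (_* length (orbit G x)) (*-comm b a)))

      b*|G|≤a*|H| : b * length G ≤ a * length H
      b*|G|≤a*|H| = subst₂ _≤_ (sym b*|G|) (sym a*|H|)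
        (*-monoʳ-≤ (a * b) (Unique∧⊆⇒length≤ (orbit-Unique G x) (orbit-⊆ x)))

      b*|G|≡a*|H|⇒orbits⊇ : b * length G ≡ a * length H → orbit H x ⊆ orbit G x
      b*|G|≡a*|H|⇒orbits⊇ e = Unique∧⊆∧length≥⇒⊇ _≟ᵗ_ (orbit-Unique G x) (orbit-⊆ x)
        (≤-reflexive (*-cancelˡ-≡ _ _ (a * b) {{>-nonZero ab>0}} (trans (sym a*|H|) (trans (sym e) b*|G|))))
        where ab>0 = *-mono-< (stabilizer-length>0 sgG x) (stabilizer-length>0 sgH x)

      orbits⊇⇒b*|G|≡a*|H| : orbit H x ⊆ orbit G x → b * length G ≡ a * length H
      orbits⊇⇒b*|G|≡a*|H| H⊆G = trans b*|G| (trans (cong ((a * b) *_) |orbits|≡) (sym a*|H|))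
        where |orbits|≡ = ≤-antisym (Unique∧⊆⇒length≤ (orbit-Unique G x) (orbit-⊆ x))
                                    (Unique∧⊆⇒length≤ (orbit-Unique H x) H⊆G)

    moment-G : (∑[ σ ∈ G ] F σ ^ k) * length H ≡ ∑[ x ∈ allVecs n k ] (Counts.a x * length H)
    moment-G = trans (cong (_* length H) (burnside k G)) (sym (∑-*ʳ (length H) Counts.a (allVecs n k)))

    moment-H : (∑[ σ ∈ H ] F σ ^ k) * length G ≡ ∑[ x ∈ allVecs n k ] (Counts.b x * length G)
    moment-H = trans (cong (_* length G) (burnside k H)) (sym (∑-*ʳ (length G) Counts.b (allVecs n k)))

  orbits⊇⇒SameAverage : (∀ (x : Vec (Fin n) k) → orbit H x ⊆ orbit G x) → SameAverage (λ σ → F σ ^ k) G H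
  orbits⊇⇒SameAverage H⊆G = trans moment-G (trans (∑-cong (allVecs n k)
    (λ {x} _ → sym (Counts.orbits⊇⇒b*|G|≡a*|H| x (H⊆G x)))) (sym moment-H))

  SameAverage⇒orbits⊇ : SameAverage (λ σ → F σ ^ k) G H → ∀ (x : Vec (Fin n) k) → orbit H x ⊆ orbit G x
  SameAverage⇒orbits⊇ same x = Counts.b*|G|≡a*|H|⇒orbits⊇ x
    (∑-≤-≡⇒≡ (allVecs n k) (λ {x} _ → Counts.b*|G|≤a*|H| x)
      (trans (sym moment-H) (trans (sym same) moment-G)) (∈-allVecs x))

-- Transitivity on tuples

module _ {n : ℕ} where
  open DecMembership (Fin._≟_ {n}) using (_∈?_)

  transposition : Fin n → Fin n → Perm n
  transposition i j = tabulate (PC.transpose i j)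

  lookup-transposition-i : ∀ i j → lookup (transposition i j) i ≡ j
  lookup-transposition-i i j rewrite lookup∘tabulate (PC.transpose i j) i | dec-true (i Fin.≟ i) refl = refl

  lookup-transposition-other : ∀ {i j k} → k ≢ i → k ≢ j → lookup (transposition i j) k ≡ k
  lookup-transposition-other {i} {j} {k} k≢i k≢j
    rewrite lookup∘tabulate (PC.transpose i j) k | dec-false (k Fin.≟ i) k≢i | dec-false (k Fin.≟ j) k≢j = refl

  Distinct-transposition : ∀ i j → Distinct (transposition i j)
  Distinct-transposition i j k l e = begin
    k                                      ≡⟨ PC.transpose-inverse j i ⟨
    PC.transpose j i (PC.transpose i j k)  ≡⟨ cong (PC.transpose j i)
                                                (trans (sym (lookup∘tabulate _ k)) (trans e (lookup∘tabulate _ l))) ⟩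
    PC.transpose j i (PC.transpose i j l)  ≡⟨ PC.transpose-inverse j i ⟩
    l                                      ∎
    where open ≡-Reasoning

  Distinct-tail : ∀ {t x} {w : Vec (Fin n) t} → Distinct (x ∷ w) → Distinct w
  Distinct-tail d i j e = Fin.suc-injective (d (suc i) (suc j) e)

  Distinct⇒∃transporter : ∀ {t} (a b : Vec (Fin n) t) → Distinct a → Distinct b →
                          Σ (Perm n) λ σ → Distinct σ × (∀ l → lookup σ (lookup a l) ≡ lookup b l)
  Distinct⇒∃transporter [] [] _ _ = idP n , Distinct-idP , λ ()
  Distinct⇒∃transporter (a₀ ∷ a) (b₀ ∷ b) da db
    with σ , dσ , σa≡b ← Distinct⇒∃transporter a b (Distinct-tail da) (Distinct-tail db) =
    transposition c b₀ ∘P σ , Distinct-∘P (transposition c b₀) σ (Distinct-transposition c b₀) dσ , λ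
      { zero    → trans (lookup-∘P (transposition c b₀) σ a₀) (lookup-transposition-i c b₀)
      ; (suc l) → trans (lookup-∘P (transposition c b₀) σ (lookup a l))
          (trans (cong (lookup (transposition c b₀)) (σa≡b l))
            (lookup-transposition-other
              (λ bₗ≡c → Fin.0≢1+n (da zero (suc l) (dσ _ _ (trans (sym bₗ≡c) (sym (σa≡b l))))))
              (λ bₗ≡b₀ → Fin.0≢1+n (db zero (suc l) (sym bₗ≡b₀))))) }
    where c = lookup σ a₀

  Sym-isTransitiveOn : ∀ t → IsTransitiveOn n t (Sym n)
  Sym-isTransitiveOn t a b da db with σ , dσ , σa≡b ← Distinct⇒∃transporter a b da db = σ , ∈-Sym⁺ σ dσ , σa≡b

  transitive-via-orbits : ∀ {t} {G H : List (Perm n)} → IsTransitiveOn n t H →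
                          (∀ (x : Vec (Fin n) t) → orbit H x ⊆ orbit G x) → IsTransitiveOn n t G
  transitive-via-orbits H-trans H⊆G a b da db
    with σ , σ∈ , σa≡b ← H-trans a b da db
    with τ , τ∈ , τa≡b ← ∈-orbit⁻ (H⊆G a (∈-orbit⁺ {y = b} σ∈
                                            (lookup⇒≡ λ l → trans (lookup-act σ a l) (σa≡b l))))
    = τ , τ∈ , λ l → trans (sym (lookup-act τ a l)) (cong (λ w → lookup w l) τa≡b)

  record Padding (U A : List (Fin n)) (t : ℕ) : Set where
    field
      tuple    : Vec (Fin n) t
      distinct : Distinct tuple
      avoids   : ∀ l → lookup tuple l ∉ A
      covers   : ∀ {u} → u ∈ U → u ∈ toList tuple ⊎ u ∈ A

  Padding-∷ : ∀ {U A t y} → y ∉ A → Padding U (y ∷ A) t → Padding (y ∷ U) A (suc t)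
  Padding-∷ {U} {A} {t} {y} y∉A P = record
    { tuple    = y ∷ tuple
    ; distinct = λ { zero zero _ → refl
                   ; zero (suc j) y≡aⱼ → ⊥-elim (avoids j (here (sym y≡aⱼ)))
                   ; (suc i) zero aᵢ≡y → ⊥-elim (avoids i (here aᵢ≡y))
                   ; (suc i) (suc j) aᵢ≡aⱼ → cong suc (distinct i j aᵢ≡aⱼ) }
    ; avoids   = λ { zero → y∉A ; (suc l) aₗ∈A → avoids l (there aₗ∈A) }
    ; covers   = λ { (here refl) → inj₁ (here refl) ; (there u∈U) → shift (covers u∈U) }
    }
    where
    open Padding P
    shift : ∀ {u} → u ∈ toList tuple ⊎ u ∈ y ∷ A → u ∈ y ∷ toList tuple ⊎ u ∈ A
    shift (inj₁ u∈a)         = inj₁ (there u∈a)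
    shift (inj₂ (here refl)) = inj₁ (here refl)
    shift (inj₂ (there u∈A)) = inj₂ u∈A

  fresh : ∀ {A : List (Fin n)} → length A < n → ∃ λ y → y ∉ A
  fresh {A} |A|<n with Fin.any? (λ y → ¬? (y ∈? A))
  ... | yes y∉A = y∉A
  ... | no ∄y   = ⊥-elim (<⇒≱ |A|<n (subst (_≤ length A) (length-tabulate (λ i → i))
                    (Unique∧⊆⇒length≤ (Unique.allFin⁺ n) allFin⊆A)))
    where
    allFin⊆A : allFin n ⊆ A
    allFin⊆A {y} _ = decidable-stable (y ∈? A) (λ y∉A → ∄y (y , y∉A))

  padding : ∀ (U A : List (Fin n)) t → length U ≤ t → t + length A ≤ n → Padding U A t
  padding [] A zero _ _ = record { tuple = [] ; distinct = λ () ; avoids = λ () ; covers = λ () }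
  padding [] A (suc t) _ t+|A|≤n with y , y∉A ← fresh {A} (≤-trans (s≤s (m≤n+m (length A) t)) t+|A|≤n)
    = record { Padding (Padding-∷ y∉A (padding [] (y ∷ A) t z≤n (subst (_≤ n) (sym (+-suc t (length A))) t+|A|≤n)))
             ; covers = λ () }
  padding (u ∷ U) A t |U|≤t t+|A|≤n with u ∈? A
  ... | yes u∈A = record { Padding P ; covers = λ { (here refl) → inj₂ u∈A ; (there u∈U) → Padding.covers P u∈U } }
    where P = padding U A t (≤-trans (n≤1+n _) |U|≤t) t+|A|≤n
  padding (u ∷ U) A (suc t) (s≤s |U|≤t) t+|A|≤n | no u∉A =
    Padding-∷ u∉A (padding U (u ∷ A) t |U|≤t (subst (_≤ n) (sym (+-suc t (length A))) t+|A|≤n))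

  Distinct-act : ∀ {t} (σ : Perm n) (a : Vec (Fin n) t) → Distinct σ → Distinct a → Distinct (act σ a)
  Distinct-act σ a dσ da i j e = da i j (dσ _ _ (trans (sym (lookup-act σ a i)) (trans e (lookup-act σ a j))))

  act-cong : ∀ {t k} (τ σ : Perm n) (a : Vec (Fin n) t) (x : Vec (Fin n) k) →
             (∀ l → lookup τ (lookup a l) ≡ lookup σ (lookup a l)) →
             (∀ {u} → u ∈ toList x → u ∈ toList a) → act τ x ≡ act σ x
  act-cong τ σ a x τa≡σa x⊆a = lookup⇒≡ λ l →
    let l′ , aₗ′≡xₗ = ∈-toList⇒lookup a (x⊆a (∈-toList⁺ (∈ᵥ-lookup l x))) in begin
      lookup (act τ x) l       ≡⟨ lookup-act τ x l ⟩
      lookup τ (lookup x l)    ≡⟨ cong (lookup τ) aₗ′≡xₗ ⟨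
      lookup τ (lookup a l′)   ≡⟨ τa≡σa l′ ⟩
      lookup σ (lookup a l′)   ≡⟨ cong (lookup σ) aₗ′≡xₗ ⟩
      lookup σ (lookup x l)    ≡⟨ lookup-act σ x l ⟨
      lookup (act σ x) l       ∎
    where open ≡-Reasoning

  transitive⇒orbits⊇ : ∀ {t k} {G : List (Perm n)} → k ≤ t → t ≤ n → IsTransitiveOn n t G →
                       ∀ (x : Vec (Fin n) k) → orbit (Sym n) x ⊆ orbit G x
  transitive⇒orbits⊇ {t} {k} {G} k≤t t≤n G-trans x {y} y∈ = from-Sym (∈-orbit⁻ y∈)
    where
    open Padding (padding (toList x) [] t (subst (_≤ t) (sym (length-toList x)) k≤t)
                                          (subst (_≤ n) (sym (+-identityʳ t)) t≤n))
    x⊆tuple : ∀ {u} → u ∈ toList x → u ∈ toList tuple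
    x⊆tuple u∈x with covers u∈x
    ... | inj₁ u∈tuple = u∈tuple
    from-Sym : (∃ λ σ → σ ∈ Sym n × act σ x ≡ y) → y ∈ orbit G x
    from-Sym (σ , σ∈ , σx≡y)
      with τ , τ∈ , τa≡σa ← G-trans tuple (act σ tuple) distinct (Distinct-act σ tuple (∈-Sym⁻ σ∈) distinct)
      = ∈-orbit⁺ τ∈ (trans (act-cong τ σ tuple x (λ l → trans (τa≡σa l) (lookup-act σ tuple l)) x⊆tuple) σx≡y)

length-filter+length-filter-∁ : ∀ {a p} {A : Set a} {P : Pred A p} (P? : Decidable P) (xs : List A) →
                               length (filter P? xs) + length (filter (∁? P?) xs) ≡ length xs
length-filter+length-filter-∁ P? []       = refl
length-filter+length-filter-∁ P? (x ∷ xs) with P? x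
... | yes _ = cong suc (length-filter+length-filter-∁ P? xs)
... | no _  = trans (+-suc _ _) (cong suc (length-filter+length-filter-∁ P? xs))

module _ {n : ℕ} where
  open DecMembership (Fin._≟_ {n}) using (_∈?_)

  private
    unique? : ∀ {k} (w : Vec (Fin n) k) → Dec (Unique (toList w))
    unique? w = UniqueDec.unique? Fin._≟_ (toList w)

  length-fresh : ∀ {k} (w : Vec (Fin n) k) → Unique (toList w) →
                 length (filter (λ y → ¬? (y ∈? toList w)) (allFin n)) ≡ n ∸ k
  length-fresh {k} w u = begin
    length (filter (λ y → ¬? (y ∈? toList w)) (allFin n))
      ≡⟨ m+n∸m≡n (length (filter (_∈? toList w) (allFin n))) _ ⟨
    length (filter (_∈? toList w) (allFin n)) + length (filter (λ y → ¬? (y ∈? toList w)) (allFin n))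
      ∸ length (filter (_∈? toList w) (allFin n))
      ≡⟨ cong₂ _∸_ (trans (length-filter+length-filter-∁ (_∈? toList w) (allFin n)) (length-tabulate (λ i → i)))
                   (trans length-used (length-toList w)) ⟩
    n ∸ k ∎
    where
    open ≡-Reasoning
    length-used : length (filter (_∈? toList w) (allFin n)) ≡ length (toList w)
    length-used = ≤-antisym
      (Unique∧⊆⇒length≤ (Unique.filter⁺ _ (Unique.allFin⁺ n))
                        (λ y∈ → proj₂ (∈-filter⁻ (_∈? toList w) {xs = allFin n} y∈)))
      (Unique∧⊆⇒length≤ u (λ {y} y∈w → ∈-filter⁺ (_∈? toList w) (∈-allFin y) y∈w))

  iverson-unique?-∷ : ∀ {k} y (w : Vec (Fin n) k) →
                      iverson (unique? (y ∷ w)) ≡ iverson (¬? (y ∈? toList w)) * iverson (unique? w)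
  iverson-unique?-∷ y w with All.all? (λ z → ¬? (y Fin.≟ z)) (toList w) | ¬? (y ∈? toList w) | unique? w
  ... | yes y∉w | yes _   | yes _ = refl
  ... | yes _   | yes _   | no _  = refl
  ... | yes y∉w | no ¬y∉w | _     = ⊥-elim (¬y∉w (All¬⇒¬Any y∉w))
  ... | no ¬y∉w | yes y∉w | _     = ⊥-elim (¬y∉w (¬Any⇒All¬ (toList w) y∉w))
  ... | no _    | no _    | yes _ = refl
  ... | no _    | no _    | no _  = refl

  ∑-fresh : ∀ {k} (w : Vec (Fin n) k) →
            ∑[ y ∈ allFin n ] (iverson (¬? (y ∈? toList w)) * iverson (unique? w)) ≡ (n ∸ k) * iverson (unique? w)
  ∑-fresh {k} w with unique? w
  ... | no _  = trans (∑-zero (allFin n) (λ {y} _ → *-zeroʳ (iverson (¬? (y ∈? toList w))))) (sym (*-zeroʳ (n ∸ k)))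
  ... | yes u = trans (∑-*ʳ 1 (λ y → iverson (¬? (y ∈? toList w))) (allFin n)) (cong (_* 1)
    (trans (sym (length-filter≡∑-iverson (λ y → ¬? (y ∈? toList w)) (allFin n))) (length-fresh w u)))

  length-Unique-tuples : ∀ k → length (filter unique? (allVecs n k)) ≡ n P′ k
  length-Unique-tuples zero    = refl
  length-Unique-tuples (suc k) = begin
    length (filter unique? (allVecs n (suc k)))
      ≡⟨ length-filter≡∑-iverson unique? (allVecs n (suc k)) ⟩
    ∑[ v ∈ allVecs n (suc k) ] iverson (unique? v)
      ≡⟨ ∑-concatMap (λ v → iverson (unique? v)) (λ y → map (y ∷_) (allVecs n k)) (allFin n) ⟩
    ∑[ y ∈ allFin n ] ∑[ v ∈ map (y ∷_) (allVecs n k) ] iverson (unique? v)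
      ≡⟨ ∑-cong (allFin n) (λ {y} _ → trans (∑-map (λ v → iverson (unique? v)) (y ∷_) (allVecs n k))
                                            (∑-cong (allVecs n k) (λ {w} _ → iverson-unique?-∷ y w))) ⟩
    ∑[ y ∈ allFin n ] ∑[ w ∈ allVecs n k ] (iverson (¬? (y ∈? toList w)) * iverson (unique? w))
      ≡⟨ ∑-swap (λ y w → iverson (¬? (y ∈? toList w)) * iverson (unique? w)) (allFin n) (allVecs n k) ⟩
    ∑[ w ∈ allVecs n k ] ∑[ y ∈ allFin n ] (iverson (¬? (y ∈? toList w)) * iverson (unique? w))
      ≡⟨ ∑-cong (allVecs n k) (λ {w} _ → ∑-fresh w) ⟩
    ∑[ w ∈ allVecs n k ] ((n ∸ k) * iverson (unique? w))
      ≡⟨ ∑-*ˡ (n ∸ k) (λ w → iverson (unique? w)) (allVecs n k) ⟩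
    (n ∸ k) * (∑[ w ∈ allVecs n k ] iverson (unique? w))
      ≡⟨ cong ((n ∸ k) *_) (trans (sym (length-filter≡∑-iverson unique? (allVecs n k))) (length-Unique-tuples k)) ⟩
    (n ∸ k) * (n P′ k) ∎
    where open ≡-Reasoning

  length-Sym : length (Sym n) ≡ n !
  length-Sym = trans (length-Unique-tuples n) nP′n≡n!
    where
    nP′n≡n! : n P′ n ≡ n !
    nP′n≡n! = trans (cong (if_then n P′ n else 0) (sym (Equivalence.to T-≡ (≤⇒≤ᵇ (≤-refl {n})))))
                    (nPn≡n! n)

module _ {a} {A : Set a} (xs ys : List A) where

  SameAverage-cong : ∀ {f h : A → ℕ} → (∀ {x} → x ∈ xs → f x ≡ h x) → (∀ {x} → x ∈ ys → f x ≡ h x) →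
                     SameAverage f xs ys → SameAverage h xs ys
  SameAverage-cong f≡h f≡h′ same = trans (cong (_* length ys) (sym (∑-cong xs f≡h)))
                                         (trans same (cong (_* length xs) (∑-cong ys f≡h′)))

  SameAverage-1 : SameAverage (λ _ → 1) xs ys
  SameAverage-1 = trans (cong (_* length ys) (∑-1 xs))
                        (trans (*-comm (length xs) (length ys)) (cong (_* length xs) (sym (∑-1 ys))))

  SameAverage-*ˡ : ∀ c {f : A → ℕ} → SameAverage f xs ys → SameAverage (λ x → c * f x) xs ys
  SameAverage-*ˡ c {f} same = begin
    (∑[ x ∈ xs ] c * f x) * length ys  ≡⟨ cong (_* length ys) (∑-*ˡ c f xs) ⟩
    c * ∑ f xs * length ys             ≡⟨ *-assoc c _ _ ⟩
    c * (∑ f xs * length ys)           ≡⟨ cong (c *_) same ⟩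
    c * (∑ f ys * length xs)           ≡⟨ *-assoc c _ _ ⟨
    c * ∑ f ys * length xs             ≡⟨ cong (_* length xs) (∑-*ˡ c f ys) ⟨
    (∑[ x ∈ ys ] c * f x) * length xs  ∎
    where open ≡-Reasoning

  SameAverage-+⁻ˡ : ∀ {f h : A → ℕ} → SameAverage (λ x → f x + h x) xs ys → SameAverage h xs ys →
                    SameAverage f xs ys
  SameAverage-+⁻ˡ {f} {h} same+ sameʰ = +-cancelʳ-≡ (∑ h xs * length ys) _ _ (begin
    ∑ f xs * length ys + ∑ h xs * length ys  ≡⟨ *-distribʳ-+ (length ys) (∑ f xs) (∑ h xs) ⟨
    (∑ f xs + ∑ h xs) * length ys            ≡⟨ cong (_* length ys) (∑-+ f h xs) ⟨
    (∑[ x ∈ xs ] f x + h x) * length ys      ≡⟨ same+ ⟩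
    (∑[ x ∈ ys ] f x + h x) * length xs      ≡⟨ cong (_* length xs) (∑-+ f h ys) ⟩
    (∑ f ys + ∑ h ys) * length xs            ≡⟨ *-distribʳ-+ (length xs) (∑ f ys) (∑ h ys) ⟩
    ∑ f ys * length xs + ∑ h ys * length xs  ≡⟨ cong (∑ f ys * length xs +_) sameʰ ⟨
    ∑ f ys * length xs + ∑ h xs * length ys  ∎)
    where open ≡-Reasoning

  module _ (n : ℕ) (g : A → ℕ) (g≤n : ∀ {x} → x ∈ xs → g x ≤ n) (g≤n′ : ∀ {x} → x ∈ ys → g x ≤ n)
           {t : ℕ} (powers : ∀ k → k ≤ t → SameAverage (λ x → g x ^ k) xs ys) where

    SameAverage-mixedPowers : ∀ k j → j + k ≤ t → SameAverage (λ x → g x ^ j * (n ∸ g x) ^ k) xs ys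
    SameAverage-mixedPowers zero    j j+0≤t = SameAverage-cong (λ _ → sym (*-identityʳ _)) (λ _ → sym (*-identityʳ _))
      (powers j (subst (_≤ t) (+-identityʳ j) j+0≤t))
    SameAverage-mixedPowers (suc k) j j+1+k≤t = SameAverage-+⁻ˡ
      (SameAverage-cong (split ∘ g≤n) (split ∘ g≤n′)
        (SameAverage-*ˡ n (SameAverage-mixedPowers k j (≤-trans (+-monoʳ-≤ j (n≤1+n k)) j+1+k≤t))))
      (SameAverage-mixedPowers k (suc j) (subst (_≤ t) (+-suc j k) j+1+k≤t))
      where
      -- n·vʲ(n-v)ᵏ = vʲ(n-v)ᵏ⁺¹ + vʲ⁺¹(n-v)ᵏ, from n = (n - v) + v for v ≤ n.
      split : ∀ {x} → g x ≤ n →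
              n * (g x ^ j * (n ∸ g x) ^ k) ≡ g x ^ j * (n ∸ g x) ^ suc k + g x ^ suc j * (n ∸ g x) ^ k
      split {x} gx≤n = trans (cong (_* (g x ^ j * (n ∸ g x) ^ k)) (sym (m∸n+n≡m gx≤n)))
                             (distribute (n ∸ g x) (g x) (g x ^ j) ((n ∸ g x) ^ k))
        where
        distribute : ∀ w v p q → (w + v) * (p * q) ≡ p * (w * q) + v * p * q
        distribute = solve-∀

    SameAverage-complementPowers : ∀ k → k ≤ t → SameAverage (λ x → (n ∸ g x) ^ k) xs ys
    SameAverage-complementPowers k k≤t = SameAverage-cong (λ _ → *-identityˡ _) (λ _ → *-identityˡ _)
      (SameAverage-mixedPowers k 0 k≤t)

toℚᵘ-/ : ∀ a q .{{_ : NonZero q}} → toℚᵘ (pos a / q) ≃ᵘ mkℚᵘ (pos a) (pred q)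
toℚᵘ-/ a q = ℚᵘ.≃-trans (ℚᵘ.≃-reflexive (cong toℚᵘ (/-cong {pos a} refl (sym (suc-pred q)))))
                        (toℚᵘ-fromℚᵘ (mkℚᵘ (pos a) (pred q)))

/-+ : ∀ a b q .{{_ : NonZero q}} → pos a / q +ℚ pos b / q ≡ pos (a + b) / q
/-+ a b q = toℚᵘ-injective (ℚᵘ.≃-trans (toℚᵘ-homo-+ (pos a / q) (pos b / q))
  (ℚᵘ.≃-trans (ℚᵘ.+-cong (toℚᵘ-/ a q) (toℚᵘ-/ b q))
  (ℚᵘ.≃-trans (*≡* same-denominator) (ℚᵘ.≃-sym (toℚᵘ-/ (a + b) q)))))
  where
  d = pos (suc (pred q))
  factor : ∀ x y z → (x *ℤ z +ℤ y *ℤ z) *ℤ z ≡ (x +ℤ y) *ℤ (z *ℤ z)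
  factor = ℤ-Solver.solve-∀
  same-denominator : (pos a *ℤ d +ℤ pos b *ℤ d) *ℤ d ≡ pos (a + b) *ℤ (d *ℤ d)
  same-denominator = trans (factor (pos a) (pos b) d) (cong (_*ℤ (d *ℤ d)) (sym (ℤ.pos-+ a b)))

/-* : ∀ a b q .{{_ : NonZero q}} → (pos a / q) *ℚ (pos b / 1) ≡ pos (a * b) / q
/-* a b q = toℚᵘ-injective (ℚᵘ.≃-trans (toℚᵘ-homo-* (pos a / q) (pos b / 1))
  (ℚᵘ.≃-trans (ℚᵘ.*-cong (toℚᵘ-/ a q) (toℚᵘ-/ b 1))
  (ℚᵘ.≃-trans (*≡* integral) (ℚᵘ.≃-sym (toℚᵘ-/ (a * b) q)))))
  where
  d = pos (suc (pred q))
  integral : (pos a *ℤ pos b) *ℤ d ≡ pos (a * b) *ℤ (d *ℤ pos 1)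
  integral = trans (cong (_*ℤ d) (sym (ℤ.pos-* a b))) (cong (pos (a * b) *ℤ_) (sym (ℤ.*-identityʳ d)))

/-≡⇒*-≡ : ∀ a c q r {{_ : NonZero q}} {{_ : NonZero r}} → pos a / q ≡ pos c / r → a * r ≡ c * q
/-≡⇒*-≡ = normalize-injective-≃

*-≡⇒/-≡ : ∀ a c q r .{{_ : NonZero q}} .{{_ : NonZero r}} → a * r ≡ c * q → pos a / q ≡ pos c / r
*-≡⇒/-≡ a c q r ar≡cq =
  toℚᵘ-injective (ℚᵘ.≃-trans (toℚᵘ-/ a q) (ℚᵘ.≃-trans (*≡* cross) (ℚᵘ.≃-sym (toℚᵘ-/ c r))))
  where
  cross : pos a *ℤ pos (suc (pred r)) ≡ pos c *ℤ pos (suc (pred q))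
  cross = begin
    pos a *ℤ pos (suc (pred r))  ≡⟨ cong (λ z → pos a *ℤ pos z) (suc-pred r) ⟩
    pos a *ℤ pos r               ≡⟨ ℤ.pos-* a r ⟨
    pos (a * r)                  ≡⟨ cong pos ar≡cq ⟩
    pos (c * q)                  ≡⟨ ℤ.pos-* c q ⟩
    pos c *ℤ pos q               ≡⟨ cong (λ z → pos c *ℤ pos z) (suc-pred q) ⟨
    pos c *ℤ pos (suc (pred q))  ∎
    where open ≡-Reasoning

-- The design condition for subgroups

sumTo-/ : ∀ n (c e : ℕ → ℕ) q .{{_ : NonZero q}} →
          sumTo n (λ j → (pos (c j) / q) *ℚ ℕtoℚ (e j)) ≡ pos (∑[ j ∈ upTo (suc n) ] c j * e j) / q
sumTo-/ n c e q = go (upTo (suc n))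
  where
  go : ∀ js → foldr (λ j acc → (pos (c j) / q) *ℚ ℕtoℚ (e j) +ℚ acc) 0ℚ js ≡ pos (∑[ j ∈ js ] c j * e j) / q
  go []       = sym (0/n≡0 q)
  go (j ∷ js) = trans (cong₂ _+ℚ_ (/-* (c j) (e j) q) (go js)) (/-+ (c j * e j) _ q)

module _ {n : ℕ} where

  F≤n : ∀ (σ : Perm n) → F σ ≤ n
  F≤n σ = subst (F σ ≤_) (length-tabulate (λ i → i)) (length-filter (λ i → lookup σ i Fin.≟ i) (allFin n))

  ∈-upTo-∸ : ∀ m → n ∸ m ∈ upTo (suc n)
  ∈-upTo-∸ m = ∈-upTo⁺ (s≤s (m∸n≤m n m))

  ∑-distanceMoment-Sym : ∀ i → ∑[ j ∈ upTo (suc n) ] v n j * j ^ i ≡ ∑[ σ ∈ Sym n ] (n ∸ F σ) ^ i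
  ∑-distanceMoment-Sym i = trans
    (∑-cong (upTo (suc n)) λ j∈ →
      cong (λ c → length c * _) (filter-≐ _ _ (F≡n∸j⇔n∸F≡j (∈-upTo⁻ j∈)) (Sym n)))
    (∑-fibres Nat._≟_ (λ σ → n ∸ F σ) (_^ i) (Sym n) (Unique.upTo⁺ (suc n)) (λ {σ} _ → ∈-upTo-∸ (F σ)))
    where
    F≡n∸j⇔n∸F≡j : ∀ {j} → j < suc n → (λ σ → F σ ≡ n ∸ j) ≐ (λ σ → n ∸ F σ ≡ j)
    F≡n∸j⇔n∸F≡j (s≤s j≤n) = (λ {σ} e → trans (cong (n ∸_) e) (m∸[m∸n]≡n j≤n))
                          , (λ {σ} e → trans (sym (m∸[m∸n]≡n (F≤n σ))) (cong (n ∸_) e))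

  module _ {D : List (Perm n)} (sg : IsSubgroup n D) where
    open Subgroup sg

    ∑-dS-right-translate : ∀ (h : ℕ → ℕ) {θ} → θ ∈ D →
                           ∑[ σ ∈ D ] h (dS σ θ) ≡ ∑[ σ ∈ D ] h (n ∸ F σ)
    ∑-dS-right-translate h {θ} θ∈ = trans (sym (∑-map (λ σ → h (n ∸ F σ)) (_∘P invP θ) D))
      (unique∧set⇒∑≡ (λ σ → h (n ∸ F σ)) image-Unique unique image⊆D
        (Unique∧⊆∧length≥⇒⊇ _≟ᵖ_ image-Unique image⊆D (≤-reflexive (sym (length-map (_∘P invP θ) D)))))
      where
      _≟ᵖ_ : DecidableEquality (Perm n)
      _≟ᵖ_ = ≡-dec Fin._≟_
      image-Unique : Unique (map (_∘P invP θ) D)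
      image-Unique = Unique.map⁺ (∘P-cancelʳ (invP θ) (Distinct-invP θ (distinct θ∈))) unique
      image⊆D : map (_∘P invP θ) D ⊆ D
      image⊆D σ∈ with ∈-map⁻ (_∘P invP θ) σ∈
      ... | σ′ , σ′∈ , refl = ∘P-closed σ′∈ (invP-closed θ∈)

    ∑-dS : ∀ (h : ℕ → ℕ) →
           ∑[ p ∈ cartesianProduct D D ] h (dS (proj₁ p) (proj₂ p)) ≡ length D * (∑[ σ ∈ D ] h (n ∸ F σ))
    ∑-dS h = begin
      ∑[ p ∈ cartesianProduct D D ] h (dS (proj₁ p) (proj₂ p))
        ≡⟨ ∑-cartesianProduct (λ p → h (dS (proj₁ p) (proj₂ p))) D D ⟩
      ∑[ σ ∈ D ] ∑[ θ ∈ D ] h (dS σ θ)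
        ≡⟨ ∑-swap (λ σ θ → h (dS σ θ)) D D ⟩
      ∑[ θ ∈ D ] ∑[ σ ∈ D ] h (dS σ θ)
        ≡⟨ ∑-cong D (∑-dS-right-translate h) ⟩
      ∑[ θ ∈ D ] ∑[ σ ∈ D ] h (n ∸ F σ)
        ≡⟨ ∑-const _ D ⟩
      length D * (∑[ σ ∈ D ] h (n ∸ F σ)) ∎
      where open ≡-Reasoning

  sumTo-freq : ∀ {d ds} → IsSubgroup n (d ∷ ds) → ∀ i →
               sumTo n (λ j → freq (d ∷ ds) j *ℚ ℕtoℚ (j ^ i))
               ≡ pos (suc (length ds) * (∑[ σ ∈ d ∷ ds ] (n ∸ F σ) ^ i)) / (suc (length ds) * suc (length ds))
  sumTo-freq {d} {ds} sg i = trans (sumTo-/ n count (_^ i) (m * m)) (cong (λ z → pos z / (m * m)) (trans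
    (∑-fibres Nat._≟_ (λ p → dS (proj₁ p) (proj₂ p)) (_^ i) (cartesianProduct D D) (Unique.upTo⁺ (suc n))
              (λ {p} _ → ∈-upTo-∸ (F (proj₁ p ∘P invP (proj₂ p)))))
    (∑-dS sg (_^ i))))
    where
    D = d ∷ ds
    m = suc (length ds)
    count : ℕ → ℕ
    count j = length (filter (λ p → dS (proj₁ p) (proj₂ p) Nat.≟ j) (cartesianProduct D D))

  sumTo-v : ∀ i → sumTo n (λ j → (_/_ (pos (v n j)) (n !) {{n !≢0}}) *ℚ ℕtoℚ (j ^ i))
                  ≡ _/_ (pos (∑[ σ ∈ Sym n ] (n ∸ F σ) ^ i)) (n !) {{n !≢0}}
  sumTo-v i = trans (sumTo-/ n (v n) (_^ i) (n !) {{n !≢0}})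
                    (cong (λ z → _/_ (pos z) (n !) {{n !≢0}}) (∑-distanceMoment-Sym i))

  DesignEquation : List (Perm n) → ℕ → Set
  DesignEquation D i = sumTo n (λ j → freq D j *ℚ ℕtoℚ (j ^ i))
                       ≡ sumTo n (λ j → (_/_ (pos (v n j)) (n !) {{n !≢0}}) *ℚ ℕtoℚ (j ^ i))

  designEquation⇔SameAverage : ∀ {D} → IsSubgroup n D → ∀ i →
                               DesignEquation D i ⇔ SameAverage (λ σ → (n ∸ F σ) ^ i) D (Sym n)
  designEquation⇔SameAverage {[]} sg i with () ← Subgroup.idP∈ sg
  designEquation⇔SameAverage {D@(d ∷ ds)} sg i = mk⇔
    (λ eq → cancel (/-≡⇒*-≡ (m * A) B (m * m) (n !) {{_}} {{n !≢0}}
                      (trans (sym (sumTo-freq sg i)) (trans eq (sumTo-v i)))))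
    (λ same → trans (sumTo-freq sg i) (trans (*-≡⇒/-≡ (m * A) B (m * m) (n !) {{_}} {{n !≢0}} (uncancel same))
                                              (sym (sumTo-v i))))
    where
    m = suc (length ds)
    A = ∑[ σ ∈ D ] (n ∸ F σ) ^ i
    B = ∑[ σ ∈ Sym n ] (n ∸ F σ) ^ i
    rearrange : ∀ a b c → (a * b) * c ≡ (b * c) * a
    rearrange = solve-∀
    cancel : m * A * n ! ≡ B * (m * m) → A * length (Sym n) ≡ B * m
    cancel e = subst (λ N → A * N ≡ B * m) (sym (length-Sym {n}))
      (*-cancelʳ-≡ (A * n !) (B * m) m (trans (sym (rearrange m A (n !))) (trans e (sym (*-assoc B m m)))))
    uncancel : A * length (Sym n) ≡ B * m → m * A * n ! ≡ B * (m * m)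
    uncancel same = trans (rearrange m A (n !))
      (trans (cong (_* m) (subst (λ N → A * N ≡ B * m) (length-Sym {n}) same)) (*-assoc B m m))

theorem2 : (t n : ℕ) → 1 ≤ t → 1 ≤ n → t ≤ n →
    ((D : List (Perm n)) → IsTTransitiveGroup n t D → IsDesign n t D) ×
    ((D : List (Perm n)) → IsSubgroup n D → IsDesign n t D → IsTTransitiveGroup n t D)
theorem2 t n _ _ t≤n = transitive⇒design , design⇒transitive
  where
  transitive⇒design : (D : List (Perm n)) → IsTTransitiveGroup n t D → IsDesign n t D
  transitive⇒design D (sg , D-transitive) i _ i≤t =
    Equivalence.from (designEquation⇔SameAverage sg i)
      (SameAverage-complementPowers D (Sym n) n F (λ {σ} _ → F≤n σ) (λ {σ} _ → F≤n σ) fixedPointMoments i i≤t)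
    where
    fixedPointMoments : ∀ k → k ≤ t → SameAverage (λ σ → F σ ^ k) D (Sym n)
    fixedPointMoments k k≤t = orbits⊇⇒SameAverage sg Sym-isSubgroup (Subgroup.⊆Sym sg)
                                (transitive⇒orbits⊇ k≤t t≤n D-transitive)

  design⇒transitive : (D : List (Perm n)) → IsSubgroup n D → IsDesign n t D → IsTTransitiveGroup n t D
  design⇒transitive D sg design =
    sg , transitive-via-orbits (Sym-isTransitiveOn t)
           (SameAverage⇒orbits⊇ sg Sym-isSubgroup (Subgroup.⊆Sym sg) fixedPointMoment)
    where
    distanceMoments : ∀ k → k ≤ t → SameAverage (λ σ → (n ∸ F σ) ^ k) D (Sym n)
    distanceMoments zero    _   = SameAverage-1 D (Sym n)
    distanceMoments (suc k) k<t = Equivalence.to (designEquation⇔SameAverage sg (suc k)) (design (suc k) (s≤s z≤n) k<t)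
    fixedPointMoment : SameAverage (λ σ → F σ ^ t) D (Sym n)
    fixedPointMoment = SameAverage-cong D (Sym n) (λ {σ} _ → F-involution σ) (λ {σ} _ → F-involution σ)
      (SameAverage-complementPowers D (Sym n) n (λ σ → n ∸ F σ) (λ {σ} _ → m∸n≤m n (F σ)) (λ {σ} _ → m∸n≤m n (F σ))
                                    distanceMoments t ≤-refl)
      where
      F-involution : ∀ σ → (n ∸ (n ∸ F σ)) ^ t ≡ F σ ^ t
      F-involution σ = cong (_^ t) (m∸[m∸n]≡n (F≤n σ))
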